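{- Let $G$ be a path graph on nodes $(v_0,v_1,\dots,v_{n-1})$ (the communication network). Suppose each node $v_i$ knows its index $i$ and an $\tilde O(1)$-bit private input $x_i$, and let $\bigoplus$ be a predefined $\tilde O(1)$-bit aggregation operator. There is a deterministic $\tilde O(1)$-round Minor-Aggregation algorithm on $G$ after which each node $v_k$ knows the prefix and suffix aggregates $\bigoplus_{i=0}^{k}x_i$ and $\bigoplus_{i=k}^{n-1}x_i$.
   Context: Minor-Aggregation model. The communication network is a connected undirected graph $G=(V,E)$ with $n=|V|$ nodes; both nodes and edges are computational units with private memory. Initially nodes know only their unique $\tilde O(1)$-bit ID (and inputs) and edges know the IDs of their endpoints. Computation proceeds in synchronous rounds, each of three steps: (i) Contraction: each edge $e$ chooses $c_e\in\{\bot,\top\}$, defining the minor $G'=G/\{e:c_e=\top\}$ (self-loops removed), whose vertices (supernodes) are identified with the sets of nodes they contain. (ii) Consensus: each node $v$ chooses an $\tilde O(1)$-bit value $x_v$; for each supernode $s$ all nodes of $s$ learn $y_s=\bigoplus_{v\in s}x_v$ for a predefined aggregation operator $\bigoplus$. (iii) Aggregation: each edge $e$ of $G'$ joining supernodes $a,b$ learns $y_a,y_b$ and chooses $\tilde O(1)$-bit values $z_{e,a},z_{e,b}$; all nodes of each supernode $s$ learn the same aggregate $\bigotimes_{e \text{ incident to } s} z_{e,s}$ for a predefined aggregation operator $\bigotimes$. An aggregation operator maps two $B$-bit messages ($B=\tilde O(1)$) to one $B$-bit message; the aggregate of several messages is obtained by repeatedly replacing two messages by their combination in arbitrary order. $\tilde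 O(\cdot)$ hides $\mathrm{poly}(\log n)$ factors. -}

module Defs where

open import Data.Bool using (Bool; true; false; if_then_else_; _∧_; not)
open import Data.Nat using (ℕ; zero; suc; _+_; _*_; _∸_; _^_; _≤_; _<_; _<ᵇ_; _≡ᵇ_; _⊓_; _⊔_)
open import Data.Nat.Logarithm using (⌊log₂_⌋)
open import Data.List using (List; []; _∷_; _++_; upTo; map; foldr; concatMap; filterᵇ)
open import Data.Bool.ListAction using (and)
open import Data.Maybe using (Maybe; just; nothing)
open import Data.Product using (_×_; _,_; proj₁; proj₂)
open import Data.Vec using (Vec)
open import Algebra.Core using (Op₂)
open import Algebra.Definitions using (Commutative; Associative)
open import Relation.Binary.PropositionalEquality using (_≡_)

-- Polylogarithmic bounds:  Õ(1)  means  ≤ polylog d n  for a constant d.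

polylog : ℕ → ℕ → ℕ
polylog d n = d * (suc ⌊log₂ n ⌋) ^ d

Msg : ℕ → Set
Msg B = Vec Bool B

foldMaybe : {M : Set} → Op₂ M → List M → Maybe M
foldMaybe _⊙_ [] = nothing
foldMaybe _⊙_ (m ∷ ms) with foldMaybe _⊙_ ms
... | nothing = just m
... | just a  = just (m ⊙ a)

-- Local knowledge (private memory) of nodes and edges.  Memory is
-- unbounded, so we let it be the full transcript of what was learned.

-- A node knows its ID, its index on the path, its private input, and
-- for every past round (newest first) the consensus value y_s of its
-- supernode and the aggregate over incident minor edges (nothing if the
-- supernode had no incident edge in the minor).
record NodeKnow (b B : ℕ) : Set where
  constructor mkNK
  field
    myId    : ℕ
    myIndex : ℕ
    input   : Vec Bool b
    hist    : List (Msg B × Maybe (Msg B))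

-- An edge knows the (unordered) IDs of its endpoints, stored as
-- (smaller ID, larger ID), and for every past round (newest first)
-- either nothing (it was contracted) or the consensus values
-- (y of supernode containing lo-endpoint , y of supernode containing hi-endpoint).
record EdgeKnow (B : ℕ) : Set where
  constructor mkEK
  field
    loId  : ℕ
    hiId  : ℕ
    ehist : List (Maybe (Msg B × Msg B))

record Algorithm (n b : ℕ) : Set₁ where
  field
    B       : ℕ
    rounds  : ℕ
    -- (i) contraction choice c_e (true = ⊤ = contract)
    contract : ℕ → EdgeKnow B → Bool
    -- (ii) consensus: node value and the aggregation operator of the round
    nodeMsg  : ℕ → NodeKnow b B → Msg B
    opC      : ℕ → Op₂ (Msg B)
    opC-comm : ∀ r → Commutative _≡_ (opC r)
    opC-assoc : ∀ r → Associative _≡_ (opC r)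
    -- (iii) aggregation: the edge (already knowing y_lo, y_hi of this round)
    -- chooses (z_{e,lo-side} , z_{e,hi-side}); aggregation operator of the round
    edgeMsg  : ℕ → EdgeKnow B → Msg B × Msg B
    opA      : ℕ → Op₂ (Msg B)
    opA-comm : ∀ r → Commutative _≡_ (opA r)
    opA-assoc : ∀ r → Associative _≡_ (opA r)
    output   : NodeKnow b B → Vec Bool b × Vec Bool b

-- Execution on the path v_0 - v_1 - ... - v_{n-1}; edge j joins v_j, v_{j+1}
-- (j < n ∸ 1).  ids : ℕ → ℕ gives node IDs, x : ℕ → Vec Bool b the inputs.

module Run {n b : ℕ} (A : Algorithm n b) (ids : ℕ → ℕ) (x : ℕ → Vec Bool b) where
  open Algorithm A

  NodeStates : Set
  NodeStates = ℕ → NodeKnow b B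

  EdgeStates : Set
  EdgeStates = ℕ → EdgeKnow B

  initNodes : NodeStates
  initNodes i = mkNK (ids i) i (x i) []

  initEdges : EdgeStates
  initEdges j = mkEK (ids j ⊓ ids (suc j)) (ids j ⊔ ids (suc j)) []

  leftIsLo : ℕ → Bool
  leftIsLo j = ids j <ᵇ ids (suc j)

  -- nodes i and k lie in the same supernode iff every edge between them is contracted
  sameSN : (ℕ → Bool) → ℕ → ℕ → Bool
  sameSN c i k = and (map c (map ((i ⊓ k) +_) (upTo ((i ⊔ k) ∸ (i ⊓ k)))))

  step : ℕ → NodeStates × EdgeStates → NodeStates × EdgeStates
  step r (ns , es) = ns' , es'
    where
      c : ℕ → Bool
      c j = contract r (es j)
      xv : ℕ → Msg B
      xv i = nodeMsg r (ns i)
      y : ℕ → Msg B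
      y i = foldr (opC r) (xv i)
              (map xv (filterᵇ (λ k → sameSN c i k ∧ not (k ≡ᵇ i)) (upTo n)))
      newE : ℕ → Maybe (Msg B × Msg B)
      newE j = if c j then nothing
               else (if leftIsLo j then just (y j , y (suc j))
                                   else just (y (suc j) , y j))
      es' : EdgeStates
      es' j = mkEK (EdgeKnow.loId (es j)) (EdgeKnow.hiId (es j))
                   (newE j ∷ EdgeKnow.ehist (es j))
      zLeft zRight : ℕ → Msg B
      zLeft j  = if leftIsLo j then proj₁ (edgeMsg r (es' j)) else proj₂ (edgeMsg r (es' j))
      zRight j = if leftIsLo j then proj₂ (edgeMsg r (es' j)) else proj₁ (edgeMsg r (es' j))
      incoming : ℕ → List (Msg B)
      incoming i = concatMap
        (λ j → if c j then []
               else ((if sameSN c i j then zLeft j ∷ [] else [])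
                     ++ (if sameSN c i (suc j) then zRight j ∷ [] else [])))
        (upTo (n ∸ 1))
      ns' : NodeStates
      ns' i = mkNK (NodeKnow.myId (ns i)) (NodeKnow.myIndex (ns i)) (NodeKnow.input (ns i))
                   ((y i , foldMaybe (opA r) (incoming i)) ∷ NodeKnow.hist (ns i))

  runFrom : ℕ → ℕ → NodeStates × EdgeStates → NodeStates × EdgeStates
  runFrom r zero st = st
  runFrom r (suc k) st = runFrom (suc r) k (step r st)

  finalNodes : NodeStates
  finalNodes = proj₁ (runFrom 0 rounds (initNodes , initEdges))

  result : ℕ → Vec Bool b × Vec Bool b
  result k = output (finalNodes k)

-- Interval aggregates:  segAgg ⊕ x a l = x_a ⊕ x_{a+1} ⊕ ... ⊕ x_{a+l}.

segAgg : {X : Set} → Op₂ X → (ℕ → X) → ℕ → ℕ → X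
segAgg _⊕_ x a zero    = x a
segAgg _⊕_ x a (suc l) = segAgg _⊕_ x a l ⊕ x (a + suc l)

prefixAgg : {X : Set} → Op₂ X → (ℕ → X) → ℕ → X
prefixAgg _⊕_ x k = segAgg _⊕_ x 0 k

suffixAgg : {X : Set} → Op₂ X → (ℕ → X) → ℕ → ℕ → X
suffixAgg _⊕_ x n k = segAgg _⊕_ x k (n ∸ 1 ∸ k)

ValidIDs : ℕ → ℕ → (ℕ → ℕ) → Set
ValidIDs c n ids =
  (∀ i j → i < n → j < n → ids i ≡ ids j → i ≡ j) × (∀ i → i < n → ids i < 2 ^ polylog c n)

-- Doubling over dyadic blocks. At level r the path is cut into blocks of 2^r
-- consecutive nodes; contracting the edges inside the blocks makes them the
-- supernodes, so consensus gives every node the aggregate of its block, and in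
-- the aggregation step the edge between two twin blocks (the halves of a block of
-- level r + 1) hands each twin the aggregate of the other. A node keeps the
-- aggregates of the part of its block up to itself and from itself on: in a right
-- twin it puts the left twin in front of the former, in a left twin it puts the
-- right twin behind the latter. After ⌊log₂ n⌋ + 1 levels one block covers the
-- path. A first round tells every edge its position, which decides contraction.

module Submission where

open import Defs
open import Data.Bool using (Bool)
open import Data.Nat using (ℕ; _≤_; _<_)
open import Data.Product using (Σ-syntax; ∃-syntax; _×_; _,_)
open import Data.Vec using (Vec)
open import Algebra.Core using (Op₂)
open import Algebra.Definitions using (Commutative; Associative)
open import Relation.Binary.PropositionalEquality using (_≡_)

open import Algebra.Bundles using (CommutativeSemigroup)
import Algebra.Properties.CommutativeSemigroup
open import Data.Bool using (true; false; T; T?; not; _∧_; _∨_; if_then_else_)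
open import Data.Bool.ListAction using (and)
open import Data.Bool.Properties
  using (if-cong; if-eta; not-involutive; T-∧; T-∨; T-≡; T-not-≡; ∧-identityʳ; ∧-zeroʳ; ∨-identityʳ; ∨-zeroʳ; ∨-comm)
open import Data.Empty using (⊥; ⊥-elim)
open import Data.List using (List; []; _∷_; _++_; upTo; map; foldr; filterᵇ; concatMap; length; head; last)
open import Data.List.Properties using (upTo-∷ʳ; map-++; filter-none)
import Data.List.Relation.Unary.All as All
open import Data.Maybe using (Maybe; just; nothing; _>>=_; fromMaybe)
open import Data.Nat using (zero; suc; pred; _+_; _*_; _∸_; _^_; z≤n; s≤s; _≤?_; _≤ᵇ_; _≡ᵇ_; _⊓_; _⊔_; ⌊_/2⌋)
open import Data.Nat.Logarithm using (⌊log₂_⌋; ⌊log₂⌋-mono-≤; ⌊log₂[2^n]⌋≡n)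
open import Data.Nat.Properties
open import Data.Product as Product using (∃; proj₁; proj₂)
open import Data.Sum using (_⊎_; inj₁; inj₂)
open import Data.Vec as Vec using ([]; _∷_; replicate; take; drop)
open import Data.Vec.Properties using (take++drop≡id; ++-injectiveˡ; ++-injectiveʳ)
open import Function using (_∘_; Equivalence)
open import Relation.Binary.Core using (_Preserves_⟶_)
open import Relation.Binary.Definitions using (tri<; tri≈; tri>)
open import Relation.Binary.PropositionalEquality
open import Relation.Binary.PropositionalEquality.Algebra using (isMagma)
open import Relation.Nullary using (¬_; yes; no)
open import Relation.Nullary.Reflects using (Reflects; ofʸ; ofⁿ; fromEquivalence)

≡ᵇ-reflects-≡ : ∀ m n → Reflects (m ≡ n) (m ≡ᵇ n)
≡ᵇ-reflects-≡ m n = fromEquivalence (≡ᵇ⇒≡ m n) (≡⇒≡ᵇ m n)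

≢⇒≡ᵇ≡false : ∀ {m n} → m ≢ n → (m ≡ᵇ n) ≡ false
≢⇒≡ᵇ≡false {m} {n} m≢n with m ≡ᵇ n | ≡ᵇ-reflects-≡ m n
... | true  | ofʸ m≡n = ⊥-elim (m≢n m≡n)
... | false | _       = refl

≡ᵇ-refl : ∀ m → (m ≡ᵇ m) ≡ true
≡ᵇ-refl zero    = refl
≡ᵇ-refl (suc m) = ≡ᵇ-refl m

≡ᵇ-sym : ∀ m n → (m ≡ᵇ n) ≡ (n ≡ᵇ m)
≡ᵇ-sym zero    zero    = refl
≡ᵇ-sym zero    (suc n) = refl
≡ᵇ-sym (suc m) zero    = refl
≡ᵇ-sym (suc m) (suc n) = ≡ᵇ-sym m n

≡ᵇ-trans : ∀ {l m n} → l ≤ m → m ≤ n → ((l ≡ᵇ m) ∧ (m ≡ᵇ n)) ≡ (l ≡ᵇ n)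
≡ᵇ-trans {l} {m} {n} l≤m m≤n with l ≡ᵇ m | ≡ᵇ-reflects-≡ l m
... | true  | ofʸ refl = refl
... | false | ofⁿ l≢m  = sym (≢⇒≡ᵇ≡false λ l≡n → l≢m (≤-antisym l≤m (subst (m ≤_) (sym l≡n) m≤n)))

≤ᵇ-refl : ∀ m → (m ≤ᵇ m) ≡ true
≤ᵇ-refl m with m ≤ᵇ m | ≤ᵇ-reflects-≤ m m
... | true  | _      = refl
... | false | ofⁿ m≰m = ⊥-elim (m≰m ≤-refl)

≤ᵇ-suc : ∀ k m → (k ≤ᵇ suc m) ≡ (k ≤ᵇ m) ∨ (k ≡ᵇ suc m)
≤ᵇ-suc zero          m       = refl
≤ᵇ-suc (suc zero)    zero    = refl
≤ᵇ-suc (suc zero)    (suc m) = refl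
≤ᵇ-suc (suc (suc k)) zero    = refl
≤ᵇ-suc (suc (suc k)) (suc m) = ≤ᵇ-suc (suc k) m

if-false : ∀ {A : Set} {b} {u v : A} → ¬ T b → (if b then u else v) ≡ v
if-false {b = true}  ¬t = ⊥-elim (¬t _)
if-false {b = false} _  = refl

<⇒≤∸1 : ∀ {m n} → m < n → m ≤ n ∸ 1
<⇒≤∸1 (s≤s m≤n) = m≤n

<∸1⇒1+< : ∀ {m n} → m < n ∸ 1 → suc m < n
<∸1⇒1+< {n = suc n} m<n = s≤s m<n

<⇒∸1< : ∀ {m n} → m < n → n ∸ 1 < n
<⇒∸1< {n = suc n} _ = n<1+n n

and-++ : ∀ bs cs → and (bs ++ cs) ≡ and bs ∧ and cs
and-++ []           cs = refl
and-++ (true  ∷ bs) cs = and-++ bs cs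
and-++ (false ∷ bs) cs = refl

and-steps : ∀ (f : ℕ → ℕ) → f Preserves _≤_ ⟶ _≤_ → ∀ (step : ℕ → Bool) a t →
            (∀ j → j < a + t → step j ≡ (f j ≡ᵇ f (suc j))) →
            and (map step (map (a +_) (upTo t))) ≡ (f a ≡ᵇ f (a + t))
and-steps f mono step a zero    _        = trans (sym (≡ᵇ-refl (f a))) (cong (λ m → f a ≡ᵇ f m) (sym (+-identityʳ a)))
and-steps f mono step a (suc t) step≡ = begin
  and (map step (map (a +_) (upTo (suc t))))             ≡⟨ cong (λ js → and (map step (map (a +_) js))) (upTo-∷ʳ t) ⟨
  and (map step (map (a +_) (upTo t ++ t ∷ [])))         ≡⟨ cong (and ∘ map step) (map-++ (a +_) (upTo t) (t ∷ [])) ⟩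
  and (map step (map (a +_) (upTo t) ++ a + t ∷ []))     ≡⟨ cong and (map-++ step (map (a +_) (upTo t)) (a + t ∷ [])) ⟩
  and (map step (map (a +_) (upTo t)) ++ step (a + t) ∷ []) ≡⟨ and-++ (map step (map (a +_) (upTo t))) (step (a + t) ∷ []) ⟩
  and (map step (map (a +_) (upTo t))) ∧ (step (a + t) ∧ true)
    ≡⟨ cong₂ (λ u v → u ∧ v) (and-steps f mono step a t (λ j j< → step≡ j (<-trans j< a+t<))) (∧-identityʳ (step (a + t))) ⟩
  (f a ≡ᵇ f (a + t)) ∧ step (a + t)                     ≡⟨ cong ((f a ≡ᵇ f (a + t)) ∧_) (step≡ (a + t) a+t<) ⟩
  (f a ≡ᵇ f (a + t)) ∧ (f (a + t) ≡ᵇ f (suc (a + t)))   ≡⟨ ≡ᵇ-trans (mono (m≤m+n a t)) (mono (n≤1+n (a + t))) ⟩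
  f a ≡ᵇ f (suc (a + t))                                ≡⟨ cong (λ m → f a ≡ᵇ f m) (+-suc a t) ⟨
  f a ≡ᵇ f (a + suc t)                                  ∎
  where
    open ≡-Reasoning
    a+t< : a + t < a + suc t
    a+t< = +-monoʳ-< a (n<1+n t)

last-∷ : ∀ {A : Set} (a : A) {as z} → last as ≡ just z → last (a ∷ as) ≡ just z
last-∷ a {_ ∷ _} last≡ = last≡

crossing : ∀ (f : ℕ → ℕ) k γ → f 0 < γ → γ ≤ f k → ∃ λ j → j < k × f j < γ × γ ≤ f (suc j)
crossing f zero    γ f0<γ γ≤fk = ⊥-elim (<⇒≱ f0<γ γ≤fk)
crossing f (suc k) γ f0<γ γ≤fk with γ ≤? f k
... | yes γ≤f = let (j , j<k , below , above) = crossing f k γ f0<γ γ≤f in j , m<n⇒m<1+n j<k , below , above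
... | no  γ≰f = k , ≤-refl , ≰⇒> γ≰f , γ≤fk

crossing-unique : ∀ {f : ℕ → ℕ} → f Preserves _≤_ ⟶ _≤_ → ∀ {γ j j'} →
                  f j < γ → γ ≤ f (suc j) → f j' < γ → γ ≤ f (suc j') → j ≡ j'
crossing-unique mono {j = j} {j'} below above below' above' with <-cmp j j'
... | tri≈ _ j≡j' _ = j≡j'
... | tri< j<j' _ _ = ⊥-elim (<⇒≱ below' (≤-trans above (mono j<j')))
... | tri> _ _ j'<j = ⊥-elim (<⇒≱ below (≤-trans above' (mono j'<j)))

-- Dyadic blocks

isOdd : ℕ → Bool
isOdd zero          = false
isOdd (suc zero)    = true
isOdd (suc (suc n)) = isOdd n

⌊n/2⌋<m : ∀ {n m} → n < m + m → ⌊ n /2⌋ < m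
⌊n/2⌋<m {m = m} n<2m = ≤-trans (⌊n/2⌋-mono (s≤s n<2m)) (≤-reflexive (sym (n≡⌈n+n/2⌉ m)))

⌊a/2⌋≡ᵇ⌊c/2⌋-below : ∀ {a c} → a ≤ c → (⌊ a /2⌋ ≡ᵇ ⌊ c /2⌋) ≡ (a ≡ᵇ c) ∨ (isOdd c ∧ (suc a ≡ᵇ c))
⌊a/2⌋≡ᵇ⌊c/2⌋-below {zero}        {zero}        _ = refl
⌊a/2⌋≡ᵇ⌊c/2⌋-below {zero}        {suc zero}    _ = refl
⌊a/2⌋≡ᵇ⌊c/2⌋-below {zero}        {suc (suc c)} _ = sym (∧-zeroʳ (isOdd c))
⌊a/2⌋≡ᵇ⌊c/2⌋-below {suc zero}    {suc zero}    _ = refl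
⌊a/2⌋≡ᵇ⌊c/2⌋-below {suc zero}    {suc (suc zero)} _ = refl
⌊a/2⌋≡ᵇ⌊c/2⌋-below {suc zero}    {suc (suc (suc c))} _ = sym (∧-zeroʳ (isOdd (suc c)))
⌊a/2⌋≡ᵇ⌊c/2⌋-below {suc (suc a)} {suc (suc c)} (s≤s (s≤s a≤c)) = ⌊a/2⌋≡ᵇ⌊c/2⌋-below a≤c

⌊a/2⌋≡ᵇ⌊c/2⌋-above : ∀ {a c} → c ≤ a → (⌊ a /2⌋ ≡ᵇ ⌊ c /2⌋) ≡ (a ≡ᵇ c) ∨ (not (isOdd c) ∧ (a ≡ᵇ suc c))
⌊a/2⌋≡ᵇ⌊c/2⌋-above {zero}        {zero}        _ = refl
⌊a/2⌋≡ᵇ⌊c/2⌋-above {suc zero}    {zero}        _ = refl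
⌊a/2⌋≡ᵇ⌊c/2⌋-above {suc (suc a)} {zero}        _ = refl
⌊a/2⌋≡ᵇ⌊c/2⌋-above {suc zero}    {suc zero}    _ = refl
⌊a/2⌋≡ᵇ⌊c/2⌋-above {suc (suc a)} {suc zero}    _ = refl
⌊a/2⌋≡ᵇ⌊c/2⌋-above {suc zero}    {suc (suc c)} (s≤s ())
⌊a/2⌋≡ᵇ⌊c/2⌋-above {suc (suc a)} {suc (suc c)} (s≤s (s≤s c≤a)) = ⌊a/2⌋≡ᵇ⌊c/2⌋-above c≤a

block : ℕ → ℕ → ℕ
block zero    i = i
block (suc r) i = ⌊ block r i /2⌋

block-mono : ∀ r → block r Preserves _≤_ ⟶ _≤_
block-mono zero    i≤j = i≤j
block-mono (suc r) i≤j = ⌊n/2⌋-mono (block-mono r i≤j)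

block-suc : ∀ r j → block r (suc j) ≤ suc (block r j)
block-suc zero    j = ≤-refl
block-suc (suc r) j = ⌊n/2⌋-mono (≤-trans (block-suc r j) (n≤1+n _))

block-zero : ∀ r → block r 0 ≡ 0
block-zero zero    = refl
block-zero (suc r) = cong ⌊_/2⌋ (block-zero r)

block-< : ∀ r s k → k < 2 ^ (r + s) → block r k < 2 ^ s
block-< zero    s k k< = k<
block-< (suc r) s k k< = ⌊n/2⌋<m (subst (block r k <_) (cong (2 ^ s +_) (+-identityʳ (2 ^ s)))
  (block-< r (suc s) k (subst (λ e → k < 2 ^ e) (sym (+-suc r s)) k<)))

block-vanishes : ∀ r k → k < 2 ^ r → block r k ≡ 0
block-vanishes r k k< = n<1⇒n≡0 (block-< r 0 k (subst (λ e → k < 2 ^ e) (sym (+-identityʳ r)) k<))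

twin : ℕ → ℕ
twin β = if isOdd β then pred β else suc β

twin-≢ : ∀ β → twin β ≢ β
twin-≢ zero    ()
twin-≢ (suc β) with isOdd (suc β)
... | true  = 1+n≢n ∘ sym
... | false = 1+n≢n

twin-odd : ∀ {β} → isOdd β ≡ true → suc (twin β) ≡ β
twin-odd {suc β} odd = cong (λ b → suc (if b then β else suc (suc β))) odd

twin-even : ∀ {β} → isOdd β ≡ false → twin β ≡ suc β
twin-even {β} even = cong (λ b → if b then pred β else suc β) even

isOdd-suc : ∀ a → isOdd (suc a) ≡ not (isOdd a)
isOdd-suc zero          = refl
isOdd-suc (suc zero)    = refl
isOdd-suc (suc (suc a)) = isOdd-suc a

upperTwin : ℕ → ℕ
upperTwin β = if isOdd β then β else suc β

upperTwin-odd : ∀ {β} → isOdd β ≡ true → upperTwin β ≡ β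
upperTwin-odd {β} odd = cong (λ b → if b then β else suc β) odd

upperTwin-even : ∀ {β} → isOdd β ≡ false → upperTwin β ≡ suc β
upperTwin-even {β} even = cong (λ b → if b then β else suc β) even

isOdd-upperTwin : ∀ β → isOdd (upperTwin β) ≡ true
isOdd-upperTwin β with isOdd β in parity
... | true  = parity
... | false = trans (isOdd-suc β) (cong not parity)

upperTwin-nonzero : ∀ β → upperTwin β ≢ 0
upperTwin-nonzero β top≡0 with trans (cong isOdd (sym top≡0)) (isOdd-upperTwin β)
... | ()

block-zero<upperTwin : ∀ r β → block r 0 < upperTwin β
block-zero<upperTwin r β = subst (_< upperTwin β) (sym (block-zero r)) (n≢0⇒n>0 (upperTwin-nonzero β))

mergesAt : ℕ → ℕ → Bool
mergesAt r j = not (isOdd (block r j)) ∧ (block r (suc j) ≡ᵇ suc (block r j))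

merging-even : ∀ r j → mergesAt r j ≡ true → isOdd (block r j) ≡ false
merging-even r j merges =
  Equivalence.to T-not-≡ (proj₁ (Equivalence.to (T-∧ {not (isOdd (block r j))}) (Equivalence.from T-≡ merges)))

merging-step : ∀ r j → mergesAt r j ≡ true → block r (suc j) ≡ suc (block r j)
merging-step r j merges =
  ≡ᵇ⇒≡ _ _ (proj₂ (Equivalence.to (T-∧ {not (isOdd (block r j))}) (Equivalence.from T-≡ merges)))

joinsTwin : ℕ → ℕ → ℕ → Bool
joinsTwin r β j = ((block r j ≡ᵇ β) ∨ (block r (suc j) ≡ᵇ β)) ∧ mergesAt r j

joinsTwin-not-merging : ∀ r β j → mergesAt r j ≡ false → joinsTwin r β j ≡ false
joinsTwin-not-merging r β j stays = trans (cong (((block r j ≡ᵇ β) ∨ (block r (suc j) ≡ᵇ β)) ∧_) stays) (∧-zeroʳ _)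

joinsTwin⇒crossing : ∀ r β j → T (joinsTwin r β j) → block r j < upperTwin β × upperTwin β ≤ block r (suc j)
joinsTwin⇒crossing r β j joins = subst (block r j <_) (sym top≡) ≤-refl , ≤-reflexive (trans top≡ (sym step))
  where
    a : ℕ
    a = block r j
    near : T ((a ≡ᵇ β) ∨ (block r (suc j) ≡ᵇ β))
    near = proj₁ (Equivalence.to (T-∧ {(a ≡ᵇ β) ∨ (block r (suc j) ≡ᵇ β)}) joins)
    merges : mergesAt r j ≡ true
    merges = Equivalence.to T-≡ (proj₂ (Equivalence.to (T-∧ {(a ≡ᵇ β) ∨ (block r (suc j) ≡ᵇ β)}) joins))
    even : isOdd a ≡ false
    even = merging-even r j merges
    step : block r (suc j) ≡ suc a
    step = merging-step r j merges
    top≡ : upperTwin β ≡ suc a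
    top≡ with Equivalence.to (T-∨ {block r j ≡ᵇ β}) near
    ... | inj₁ a≡β =
      let e = ≡ᵇ⇒≡ a β a≡β in trans (upperTwin-even (subst (λ z → isOdd z ≡ false) e even)) (cong suc (sym e))
    ... | inj₂ b≡β =
      let e = trans (sym step) (≡ᵇ⇒≡ _ β b≡β)
      in trans (upperTwin-odd (subst (λ z → isOdd z ≡ true) e (trans (isOdd-suc a) (cong not even)))) (sym e)

crossing⇒joinsTwin : ∀ r β j → block r j < upperTwin β → upperTwin β ≤ block r (suc j) → joinsTwin r β j ≡ true
crossing⇒joinsTwin r β j below above =
  trans (cong (_∧ mergesAt r j) near) (cong₂ _∧_ (cong not even) (Equivalence.to T-≡ (≡⇒≡ᵇ _ _ step)))
  where
    a : ℕ
    a = block r j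
    top≡ : upperTwin β ≡ suc a
    top≡ = ≤-antisym (≤-trans above (block-suc r j)) below
    step : block r (suc j) ≡ suc a
    step = ≤-antisym (block-suc r j) (subst (_≤ block r (suc j)) top≡ above)
    even : isOdd a ≡ false
    even = begin
      isOdd a                   ≡⟨ not-involutive (isOdd a) ⟨
      not (not (isOdd a))       ≡⟨ cong not (isOdd-suc a) ⟨
      not (isOdd (suc a))       ≡⟨ cong (not ∘ isOdd) top≡ ⟨
      not (isOdd (upperTwin β)) ≡⟨ cong not (isOdd-upperTwin β) ⟩
      false                     ∎
      where open ≡-Reasoning
    near : ((a ≡ᵇ β) ∨ (block r (suc j) ≡ᵇ β)) ≡ true
    near = by-parity (isOdd β) refl
      where
        by-parity : ∀ p → isOdd β ≡ p → ((a ≡ᵇ β) ∨ (block r (suc j) ≡ᵇ β)) ≡ true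
        by-parity true  odd  =
          trans (cong (λ m → (a ≡ᵇ β) ∨ (m ≡ᵇ β)) (trans step (trans (sym top≡) (upperTwin-odd {β} odd))))
                (trans (cong ((a ≡ᵇ β) ∨_) (≡ᵇ-refl β)) (∨-zeroʳ (a ≡ᵇ β)))
        by-parity false even =
          trans (cong (λ m → (m ≡ᵇ β) ∨ (block r (suc j) ≡ᵇ β)) (suc-injective (trans (sym top≡) (upperTwin-even {β} even))))
                (cong (_∨ (block r (suc j) ≡ᵇ β)) (≡ᵇ-refl β))

-- Aggregates of selected inputs

module Aggregation {V : Set} (_⊕_ : Op₂ V) (⊕-comm : Commutative _≡_ _⊕_) (⊕-assoc : Associative _≡_ _⊕_) where

  -- ⊕ with an adjoined identity, standing for the aggregate of no inputs.
  infixl 6 _⊙_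
  _⊙_ : Op₂ (Maybe V)
  just u  ⊙ just v  = just (u ⊕ v)
  just u  ⊙ nothing = just u
  nothing ⊙ m       = m

  ⊙-identityʳ : ∀ m → m ⊙ nothing ≡ m
  ⊙-identityʳ (just u) = refl
  ⊙-identityʳ nothing  = refl

  ⊙-comm : Commutative _≡_ _⊙_
  ⊙-comm (just u) (just v) = cong just (⊕-comm u v)
  ⊙-comm (just u) nothing  = refl
  ⊙-comm nothing  m        = sym (⊙-identityʳ m)

  ⊙-assoc : Associative _≡_ _⊙_
  ⊙-assoc (just u) (just v) (just w) = cong just (⊕-assoc u v w)
  ⊙-assoc (just u) (just v) nothing  = refl
  ⊙-assoc (just u) nothing  m        = refl
  ⊙-assoc nothing  m        m'       = refl

  ⊙-commutativeSemigroup : CommutativeSemigroup _ _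
  ⊙-commutativeSemigroup = record
    { isCommutativeSemigroup = record
      { isSemigroup = record { isMagma = isMagma _⊙_ ; assoc = ⊙-assoc }
      ; comm = ⊙-comm } }

  open Algebra.Properties.CommutativeSemigroup ⊙-commutativeSemigroup public using (interchange; x∙yz≈y∙xz)

  ⨁ : List ℕ → (ℕ → Maybe V) → Maybe V
  ⨁ []       g = nothing
  ⨁ (j ∷ js) g = g j ⊙ ⨁ js g

  ⨁-++ : ∀ is js g → ⨁ (is ++ js) g ≡ ⨁ is g ⊙ ⨁ js g
  ⨁-++ []       js g = refl
  ⨁-++ (i ∷ is) js g = trans (cong (g i ⊙_) (⨁-++ is js g)) (sym (⊙-assoc (g i) (⨁ is g) (⨁ js g)))

  ⨁-distrib : ∀ js g h → ⨁ js (λ j → g j ⊙ h j) ≡ ⨁ js g ⊙ ⨁ js h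
  ⨁-distrib []       g h = refl
  ⨁-distrib (j ∷ js) g h =
    trans (cong (g j ⊙ h j ⊙_) (⨁-distrib js g h)) (interchange (g j) (h j) (⨁ js g) (⨁ js h))

  ⨁-upTo-suc : ∀ m g → ⨁ (upTo (suc m)) g ≡ ⨁ (upTo m) g ⊙ g m
  ⨁-upTo-suc m g = begin
    ⨁ (upTo (suc m)) g          ≡⟨ cong (λ js → ⨁ js g) (sym (upTo-∷ʳ m)) ⟩
    ⨁ (upTo m ++ m ∷ []) g      ≡⟨ ⨁-++ (upTo m) (m ∷ []) g ⟩
    ⨁ (upTo m) g ⊙ (g m ⊙ nothing) ≡⟨ cong (⨁ (upTo m) g ⊙_) (⊙-identityʳ (g m)) ⟩
    ⨁ (upTo m) g ⊙ g m          ∎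
    where open ≡-Reasoning

  ⨁-cong : ∀ m {g h} → (∀ j → j < m → g j ≡ h j) → ⨁ (upTo m) g ≡ ⨁ (upTo m) h
  ⨁-cong zero    g≗h = refl
  ⨁-cong (suc m) {g} {h} g≗h = begin
    ⨁ (upTo (suc m)) g  ≡⟨ ⨁-upTo-suc m g ⟩
    ⨁ (upTo m) g ⊙ g m  ≡⟨ cong₂ _⊙_ (⨁-cong m (λ j j<m → g≗h j (m<n⇒m<1+n j<m))) (g≗h m ≤-refl) ⟩
    ⨁ (upTo m) h ⊙ h m  ≡⟨ sym (⨁-upTo-suc m h) ⟩
    ⨁ (upTo (suc m)) h  ∎
    where open ≡-Reasoning

  ⨁-nothing : ∀ m {g} → (∀ j → j < m → g j ≡ nothing) → ⨁ (upTo m) g ≡ nothing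
  ⨁-nothing m g≡nothing = trans (⨁-cong m g≡nothing) (⨁-const m)
    where
      ⨁-const : ∀ m → ⨁ (upTo m) (λ _ → nothing) ≡ nothing
      ⨁-const zero    = refl
      ⨁-const (suc m) = trans (⨁-upTo-suc m _) (trans (⊙-identityʳ _) (⨁-const m))

  ⨁-single : ∀ m {g} i → i < m → (∀ j → j < m → j ≢ i → g j ≡ nothing) → ⨁ (upTo m) g ≡ g i
  ⨁-single (suc m) {g} i i<1+m elsewhere with m ≟ i
  ... | yes refl = begin
    ⨁ (upTo (suc m)) g  ≡⟨ ⨁-upTo-suc m g ⟩
    ⨁ (upTo m) g ⊙ g m  ≡⟨ cong (_⊙ g m) (⨁-nothing m (λ j j<m → elsewhere j (m<n⇒m<1+n j<m) (<⇒≢ j<m))) ⟩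
    g m                 ∎
    where open ≡-Reasoning
  ... | no m≢i = begin
    ⨁ (upTo (suc m)) g  ≡⟨ ⨁-upTo-suc m g ⟩
    ⨁ (upTo m) g ⊙ g m  ≡⟨ cong₂ _⊙_ (⨁-single m i i<m (λ j j<m → elsewhere j (m<n⇒m<1+n j<m)))
                                     (elsewhere m ≤-refl m≢i) ⟩
    g i ⊙ nothing       ≡⟨ ⊙-identityʳ (g i) ⟩
    g i                 ∎
    where
      open ≡-Reasoning
      i<m : i < m
      i<m = ≤∧≢⇒< (≤-pred i<1+m) (m≢i ∘ sym)

  -- A node in an odd (right) block adds its twin block to its prefix, one in an even block to its suffix.
  absorbTwin : Bool → Maybe V → Maybe V × Maybe V → Maybe V × Maybe V
  absorbTwin true  s (p , q) = s ⊙ p , q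
  absorbTwin false s (p , q) = p , q ⊙ s

  module Selection (n : ℕ) (x : ℕ → V) where

    keep : Bool → ℕ → Maybe V
    keep p k = if p then just (x k) else nothing

    select : (ℕ → Bool) → Maybe V
    select p = ⨁ (upTo n) (λ k → keep (p k) k)

    select-cong : ∀ {p q} → (∀ k → k < n → p k ≡ q k) → select p ≡ select q
    select-cong p≗q = ⨁-cong n (λ k k<n → cong (λ b → keep b k) (p≗q k k<n))

    select-∨ : ∀ p q → (∀ k → T (p k) → T (q k) → ⊥) → select (λ k → p k ∨ q k) ≡ select p ⊙ select q
    select-∨ p q disjoint = trans (⨁-cong n (λ k _ → keep-∨ (p k) (q k) (disjoint k))) (⨁-distrib (upTo n) _ _)
      where
        keep-∨ : ∀ b c {k} → (T b → T c → ⊥) → keep (b ∨ c) k ≡ keep b k ⊙ keep c k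
        keep-∨ true  true  disj = ⊥-elim (disj _ _)
        keep-∨ true  false _    = refl
        keep-∨ false c     _    = refl

    select-none : ∀ {p} → (∀ k → k < n → p k ≡ false) → select p ≡ nothing
    select-none p≡false = ⨁-nothing n (λ k k<n → cong (λ b → keep b k) (p≡false k k<n))

    select-single : ∀ i → i < n → select (λ k → k ≡ᵇ i) ≡ just (x i)
    select-single i i<n = trans (⨁-single n i i<n elsewhere) (cong (λ b → keep b i) (≡ᵇ-refl i))
      where
        elsewhere : ∀ k → k < n → k ≢ i → keep (k ≡ᵇ i) k ≡ nothing
        elsewhere k _ k≢i with k ≡ᵇ i | ≡ᵇ-reflects-≡ k i
        ... | true  | ofʸ k≡i = ⊥-elim (k≢i k≡i)
        ... | false | _       = refl

    select-interval : ∀ a l → a + l < n → select (λ k → (a ≤ᵇ k) ∧ (k ≤ᵇ a + l)) ≡ just (segAgg _⊕_ x a l)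
    select-interval a zero a<n =
      trans (select-cong (λ k _ → endpoints k)) (select-single a (subst (_< n) (+-identityʳ a) a<n))
      where
        endpoints : ∀ k → ((a ≤ᵇ k) ∧ (k ≤ᵇ a + 0)) ≡ (k ≡ᵇ a)
        endpoints k rewrite +-identityʳ a with k ≡ᵇ a | ≡ᵇ-reflects-≡ k a
        ... | true  | ofʸ refl rewrite ≤ᵇ-refl k = refl
        ... | false | ofⁿ k≢a with a ≤ᵇ k | ≤ᵇ-reflects-≤ a k | k ≤ᵇ a | ≤ᵇ-reflects-≤ k a
        ...   | true  | ofʸ a≤k | true  | ofʸ k≤a = ⊥-elim (k≢a (≤-antisym k≤a a≤k))
        ...   | true  | _       | false | _       = refl
        ...   | false | _       | _     | _       = refl
    select-interval a (suc l) a+l<n = begin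
      select (λ k → (a ≤ᵇ k) ∧ (k ≤ᵇ a + suc l))
        ≡⟨ select-cong (λ k _ → split k) ⟩
      select (λ k → ((a ≤ᵇ k) ∧ (k ≤ᵇ a + l)) ∨ (k ≡ᵇ a + suc l))
        ≡⟨ select-∨ _ _ disjoint ⟩
      select (λ k → (a ≤ᵇ k) ∧ (k ≤ᵇ a + l)) ⊙ select (λ k → k ≡ᵇ a + suc l)
        ≡⟨ cong₂ _⊙_ (select-interval a l (<-trans (+-monoʳ-< a (n<1+n l)) a+l<n)) (select-single (a + suc l) a+l<n) ⟩
      just (segAgg _⊕_ x a (suc l)) ∎
      where
        open ≡-Reasoning
        split : ∀ k → ((a ≤ᵇ k) ∧ (k ≤ᵇ a + suc l)) ≡ ((a ≤ᵇ k) ∧ (k ≤ᵇ a + l)) ∨ (k ≡ᵇ a + suc l)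
        split k rewrite +-suc a l | ≤ᵇ-suc k (a + l) with a ≤ᵇ k | ≤ᵇ-reflects-≤ a k
        ... | true  | _ = refl
        ... | false | ofⁿ a≰k with k ≡ᵇ suc (a + l) | ≡ᵇ-reflects-≡ k (suc (a + l))
        ...   | false | _        = refl
        ...   | true  | ofʸ refl = ⊥-elim (a≰k (≤-trans (m≤m+n a l) (n≤1+n _)))
        disjoint : ∀ k → T ((a ≤ᵇ k) ∧ (k ≤ᵇ a + l)) → T (k ≡ᵇ a + suc l) → ⊥
        disjoint k inside at-end = 1+n≰n (subst (_≤ a + l) (trans (≡ᵇ⇒≡ k _ at-end) (+-suc a l)) k≤a+l)
          where
            k≤a+l : k ≤ a + l
            k≤a+l = ≤ᵇ⇒≤ k (a + l) (proj₂ (Equivalence.to T-∧ inside))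

    prefixWithin suffixWithin : ℕ → ℕ → Maybe V
    prefixWithin r k = select (λ k' → (k' ≤ᵇ k) ∧ (block r k' ≡ᵇ block r k))
    suffixWithin r k = select (λ k' → (k ≤ᵇ k') ∧ (block r k' ≡ᵇ block r k))

    within : ℕ → ℕ → Maybe V × Maybe V
    within r k = prefixWithin r k , suffixWithin r k

    blockAgg : ℕ → ℕ → Maybe V
    blockAgg r β = select (λ k' → block r k' ≡ᵇ β)

    within-zero : ∀ k → k < n → within 0 k ≡ (just (x k) , just (x k))
    within-zero k k<n = cong₂ _,_ (only-k (_≤ᵇ k) (≤ᵇ-refl k)) (only-k (k ≤ᵇ_) (≤ᵇ-refl k))
      where
        only-k : ∀ (le : ℕ → Bool) → le k ≡ true → select (λ k' → le k' ∧ (k' ≡ᵇ k)) ≡ just (x k)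
        only-k le le-k = trans (select-cong (λ k' _ → at-k k')) (select-single k k<n)
          where
            at-k : ∀ k' → (le k' ∧ (k' ≡ᵇ k)) ≡ (k' ≡ᵇ k)
            at-k k' with k' ≡ᵇ k | ≡ᵇ-reflects-≡ k' k
            ... | true  | ofʸ refl rewrite le-k = refl
            ... | false | _                     = ∧-zeroʳ (le k')

    module _ (r k : ℕ) where
      private
        β : ℕ
        β = block r k

        not-twin : ∀ a b → T (a ≡ᵇ twin β) → T (b ∧ (a ≡ᵇ β)) → ⊥
        not-twin a b a≡twin a≡β =
          twin-≢ β (trans (sym (≡ᵇ⇒≡ a _ a≡twin)) (≡ᵇ⇒≡ a β (proj₂ (Equivalence.to (T-∧ {b}) a≡β))))

      prefix-odd : isOdd β ≡ true → prefixWithin (suc r) k ≡ blockAgg r (twin β) ⊙ prefixWithin r k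
      prefix-odd odd = trans (select-cong (λ k' _ → merge k'))
        (select-∨ (λ k' → block r k' ≡ᵇ twin β) (λ k' → (k' ≤ᵇ k) ∧ (block r k' ≡ᵇ β))
                  (λ k' → not-twin (block r k') (k' ≤ᵇ k)))
        where
          merge : ∀ k' → ((k' ≤ᵇ k) ∧ (⌊ block r k' /2⌋ ≡ᵇ ⌊ β /2⌋)) ≡ (block r k' ≡ᵇ twin β) ∨ ((k' ≤ᵇ k) ∧ (block r k' ≡ᵇ β))
          merge k' with k' ≤ᵇ k | ≤ᵇ-reflects-≤ k' k
          ... | true  | ofʸ k'≤k = begin
            ⌊ a /2⌋ ≡ᵇ ⌊ β /2⌋                   ≡⟨ ⌊a/2⌋≡ᵇ⌊c/2⌋-below (block-mono r k'≤k) ⟩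
            (a ≡ᵇ β) ∨ (isOdd β ∧ (suc a ≡ᵇ β))  ≡⟨ cong (λ b → (a ≡ᵇ β) ∨ (b ∧ (suc a ≡ᵇ β))) odd ⟩
            (a ≡ᵇ β) ∨ (suc a ≡ᵇ β)              ≡⟨ cong (λ c → (a ≡ᵇ β) ∨ (suc a ≡ᵇ c)) (twin-odd {β} odd) ⟨
            (a ≡ᵇ β) ∨ (a ≡ᵇ twin β)             ≡⟨ ∨-comm (a ≡ᵇ β) (a ≡ᵇ twin β) ⟩
            (a ≡ᵇ twin β) ∨ (a ≡ᵇ β)             ∎
            where
              open ≡-Reasoning
              a : ℕ
              a = block r k'
          ... | false | ofⁿ k'≰k = sym (trans (∨-identityʳ _) (≢⇒≡ᵇ≡false {block r k'} {twin β} (λ a≡twin →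
            <-irrefl (sym a≡twin) (<-≤-trans (≤-reflexive (twin-odd {β} odd)) (block-mono r (<⇒≤ (≰⇒> k'≰k)))))))

      prefix-even : isOdd β ≡ false → prefixWithin (suc r) k ≡ prefixWithin r k
      prefix-even even = select-cong (λ k' _ → same k')
        where
          same : ∀ k' → ((k' ≤ᵇ k) ∧ (⌊ block r k' /2⌋ ≡ᵇ ⌊ β /2⌋)) ≡ ((k' ≤ᵇ k) ∧ (block r k' ≡ᵇ β))
          same k' with k' ≤ᵇ k | ≤ᵇ-reflects-≤ k' k
          ... | true  | ofʸ k'≤k = trans (⌊a/2⌋≡ᵇ⌊c/2⌋-below (block-mono r k'≤k))
            (trans (cong (λ b → (block r k' ≡ᵇ β) ∨ (b ∧ (suc (block r k') ≡ᵇ β))) even) (∨-identityʳ _))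
          ... | false | _        = refl

      suffix-odd : isOdd β ≡ true → suffixWithin (suc r) k ≡ suffixWithin r k
      suffix-odd odd = select-cong (λ k' _ → same k')
        where
          same : ∀ k' → ((k ≤ᵇ k') ∧ (⌊ block r k' /2⌋ ≡ᵇ ⌊ β /2⌋)) ≡ ((k ≤ᵇ k') ∧ (block r k' ≡ᵇ β))
          same k' with k ≤ᵇ k' | ≤ᵇ-reflects-≤ k k'
          ... | true  | ofʸ k≤k' = trans (⌊a/2⌋≡ᵇ⌊c/2⌋-above (block-mono r k≤k'))
            (trans (cong (λ b → (block r k' ≡ᵇ β) ∨ (not b ∧ (block r k' ≡ᵇ suc β))) odd) (∨-identityʳ _))
          ... | false | _        = refl

      suffix-even : isOdd β ≡ false → suffixWithin (suc r) k ≡ suffixWithin r k ⊙ blockAgg r (twin β)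
      suffix-even even = trans (select-cong (λ k' _ → merge k'))
        (select-∨ (λ k' → (k ≤ᵇ k') ∧ (block r k' ≡ᵇ β)) (λ k' → block r k' ≡ᵇ twin β)
                  (λ k' a≡β a≡twin → not-twin (block r k') (k ≤ᵇ k') a≡twin a≡β))
        where
          merge : ∀ k' → ((k ≤ᵇ k') ∧ (⌊ block r k' /2⌋ ≡ᵇ ⌊ β /2⌋)) ≡ ((k ≤ᵇ k') ∧ (block r k' ≡ᵇ β)) ∨ (block r k' ≡ᵇ twin β)
          merge k' with k ≤ᵇ k' | ≤ᵇ-reflects-≤ k k'
          ... | true  | ofʸ k≤k' = begin
            ⌊ a /2⌋ ≡ᵇ ⌊ β /2⌋                       ≡⟨ ⌊a/2⌋≡ᵇ⌊c/2⌋-above (block-mono r k≤k') ⟩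
            (a ≡ᵇ β) ∨ (not (isOdd β) ∧ (a ≡ᵇ suc β)) ≡⟨ cong (λ b → (a ≡ᵇ β) ∨ (not b ∧ (a ≡ᵇ suc β))) even ⟩
            (a ≡ᵇ β) ∨ (a ≡ᵇ suc β)                   ≡⟨ cong (λ c → (a ≡ᵇ β) ∨ (a ≡ᵇ c)) (twin-even {β} even) ⟨
            (a ≡ᵇ β) ∨ (a ≡ᵇ twin β)                  ∎
            where
              open ≡-Reasoning
              a : ℕ
              a = block r k'
          ... | false | ofⁿ k≰k' = sym (≢⇒≡ᵇ≡false {block r k'} {twin β} (λ a≡twin →
            <-irrefl (trans a≡twin (twin-even {β} even)) (s≤s (block-mono r (<⇒≤ (≰⇒> k≰k'))))))

      within-suc : within (suc r) k ≡ absorbTwin (isOdd β) (blockAgg r (twin β)) (within r k)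
      within-suc = by-parity (isOdd β) refl
        where
          by-parity : ∀ b → isOdd β ≡ b → within (suc r) k ≡ absorbTwin b (blockAgg r (twin β)) (within r k)
          by-parity true  odd  = cong₂ _,_ (prefix-odd odd) (suffix-odd odd)
          by-parity false even = cong₂ _,_ (prefix-even even) (suffix-even even)

    within-top : ∀ r → (∀ k → k < n → block r k ≡ 0) →
                 ∀ k → k < n → within r k ≡ (just (prefixAgg _⊕_ x k) , just (suffixAgg _⊕_ x n k))
    within-top r vanish k k<n = cong₂ _,_
      (trans (select-cong (λ k' k'<n → trans (cong ((k' ≤ᵇ k) ∧_) (same-block k' k'<n)) (∧-identityʳ _)))
             (select-interval 0 k k<n))
      (trans (select-cong (λ k' k'<n → cong ((k ≤ᵇ k') ∧_) (trans (same-block k' k'<n) (sym (below-end k' k'<n)))))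
             (select-interval k (n ∸ 1 ∸ k) (subst (_< n) (sym k+l≡n-1) (<⇒∸1< k<n))))
      where
        k+l≡n-1 : k + (n ∸ 1 ∸ k) ≡ n ∸ 1
        k+l≡n-1 = m+[n∸m]≡n (<⇒≤∸1 k<n)
        same-block : ∀ k' → k' < n → (block r k' ≡ᵇ block r k) ≡ true
        same-block k' k'<n = cong₂ _≡ᵇ_ (vanish k' k'<n) (vanish k k<n)
        below-end : ∀ k' → k' < n → (k' ≤ᵇ k + (n ∸ 1 ∸ k)) ≡ true
        below-end k' k'<n = Equivalence.to T-≡ (≤⇒≤ᵇ (subst (k' ≤_) (sym k+l≡n-1) (<⇒≤∸1 k'<n)))

    twin-pair : ∀ r β j → mergesAt r j ≡ true →
      (if block r j ≡ᵇ β then blockAgg r (block r (suc j)) else nothing) ⊙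
      (if block r (suc j) ≡ᵇ β then blockAgg r (block r j) else nothing)
        ≡ (if (block r j ≡ᵇ β) ∨ (block r (suc j) ≡ᵇ β) then blockAgg r (twin β) else nothing)
    twin-pair r β j merges = delivers (merging-step r j merges) (merging-even r j merges)
      where
        delivers : block r (suc j) ≡ suc (block r j) → isOdd (block r j) ≡ false →
          (if block r j ≡ᵇ β then blockAgg r (block r (suc j)) else nothing) ⊙
          (if block r (suc j) ≡ᵇ β then blockAgg r (block r j) else nothing)
            ≡ (if (block r j ≡ᵇ β) ∨ (block r (suc j) ≡ᵇ β) then blockAgg r (twin β) else nothing)
        delivers step even with block r j ≡ᵇ β | ≡ᵇ-reflects-≡ (block r j) β
        ... | true  | ofʸ refl = begin
          blockAgg r (block r (suc j)) ⊙ (if block r (suc j) ≡ᵇ β then blockAgg r β else nothing)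
            ≡⟨ cong (λ b → blockAgg r (block r (suc j)) ⊙ (if b then blockAgg r β else nothing))
                    (≢⇒≡ᵇ≡false (λ e → 1+n≢n (trans (sym step) e))) ⟩
          blockAgg r (block r (suc j)) ⊙ nothing ≡⟨ ⊙-identityʳ _ ⟩
          blockAgg r (block r (suc j))           ≡⟨ cong (blockAgg r) (trans step (sym (twin-even {β} even))) ⟩
          blockAgg r (twin β)                    ∎
          where open ≡-Reasoning
        ... | false | _ with block r (suc j) ≡ᵇ β | ≡ᵇ-reflects-≡ (block r (suc j)) β
        ...   | true  | ofʸ refl = cong (blockAgg r) (suc-injective (sym (trans (twin-odd odd) step)))
          where
            odd : isOdd (block r (suc j)) ≡ true
            odd = trans (cong isOdd step) (trans (isOdd-suc (block r j)) (cong not even))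
        ...   | false | _        = refl

    delivered-to : ∀ r β j →
      (if block r j ≡ᵇ β then (if mergesAt r j then blockAgg r (block r (suc j)) else nothing) else nothing) ⊙
      (if block r (suc j) ≡ᵇ β then (if mergesAt r j then blockAgg r (block r j) else nothing) else nothing)
        ≡ (if joinsTwin r β j then blockAgg r (twin β) else nothing)
    delivered-to r β j = by-merging (mergesAt r j) refl
      where
        here there : Bool
        here  = block r j ≡ᵇ β
        there = block r (suc j) ≡ᵇ β
        delivered : Bool → Maybe V → Maybe V
        delivered s v = if s then v else nothing
        by-merging : ∀ m → mergesAt r j ≡ m →
          delivered here (delivered (mergesAt r j) (blockAgg r (block r (suc j)))) ⊙
          delivered there (delivered (mergesAt r j) (blockAgg r (block r j)))
            ≡ delivered (joinsTwin r β j) (blockAgg r (twin β))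
        by-merging true merges = begin
          _ ≡⟨ cong (λ m → delivered here (delivered m (blockAgg r (block r (suc j)))) ⊙
                           delivered there (delivered m (blockAgg r (block r j)))) merges ⟩
          delivered here (blockAgg r (block r (suc j))) ⊙ delivered there (blockAgg r (block r j))
            ≡⟨ twin-pair r β j merges ⟩
          delivered (here ∨ there) (blockAgg r (twin β))
            ≡⟨ if-cong (trans (cong ((here ∨ there) ∧_) merges) (∧-identityʳ _)) ⟨
          delivered (joinsTwin r β j) (blockAgg r (twin β)) ∎
          where open ≡-Reasoning
        by-merging false stays = begin
          _ ≡⟨ cong (λ m → delivered here (delivered m (blockAgg r (block r (suc j)))) ⊙
                           delivered there (delivered m (blockAgg r (block r j)))) stays ⟩
          delivered here nothing ⊙ delivered there nothing  ≡⟨ cong₂ _⊙_ (if-eta here) (if-eta there) ⟩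
          nothing                                           ≡⟨ if-cong (joinsTwin-not-merging r β j stays) ⟨
          delivered (joinsTwin r β j) (blockAgg r (twin β)) ∎
          where open ≡-Reasoning

    -- In the aggregation step of level r, summed over all edges, exactly the edge
    -- joining β to its twin delivers the twin's aggregate (if the twin exists).
    collect-twin : ∀ r β → β ≤ block r (n ∸ 1) →
      ⨁ (upTo (n ∸ 1)) (λ j → if joinsTwin r β j then blockAgg r (twin β) else nothing) ≡ blockAgg r (twin β)
    collect-twin r β β≤last with upperTwin β ≤? block r (n ∸ 1)
    ... | no top≰last = trans (⨁-nothing (n ∸ 1) silent) (sym (select-none outside))
      where
        silent : ∀ j → j < n ∸ 1 → (if joinsTwin r β j then blockAgg r (twin β) else nothing) ≡ nothing
        silent j j<n-1 = if-false λ joins →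
          top≰last (≤-trans (proj₂ (joinsTwin⇒crossing r β j joins)) (block-mono r j<n-1))
        twin≡top : twin β ≡ upperTwin β
        twin≡top = by-parity (isOdd β) refl
          where
            by-parity : ∀ p → isOdd β ≡ p → twin β ≡ upperTwin β
            by-parity true  odd  = ⊥-elim (top≰last (subst (_≤ block r (n ∸ 1)) (sym (upperTwin-odd {β} odd)) β≤last))
            by-parity false even = trans (twin-even {β} even) (sym (upperTwin-even {β} even))
        outside : ∀ k → k < n → (block r k ≡ᵇ twin β) ≡ false
        outside k k<n = ≢⇒≡ᵇ≡false λ k-in-twin →
          top≰last (subst (_≤ block r (n ∸ 1)) (trans k-in-twin twin≡top) (block-mono r (<⇒≤∸1 k<n)))
    ... | yes top≤last with crossing (block r) (n ∸ 1) (upperTwin β) (block-zero<upperTwin r β) top≤last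
    ...   | j₀ , j₀<n-1 , below , above =
      trans (⨁-single (n ∸ 1) j₀ j₀<n-1 elsewhere) (if-cong (crossing⇒joinsTwin r β j₀ below above))
      where
        elsewhere : ∀ j → j < n ∸ 1 → j ≢ j₀ → (if joinsTwin r β j then blockAgg r (twin β) else nothing) ≡ nothing
        elsewhere j _ j≢j₀ = if-false λ joins →
          let (below' , above') = joinsTwin⇒crossing r β j joins
          in j≢j₀ (crossing-unique (block-mono r) below' above' below above)

n<2^1+⌊log₂n⌋ : ∀ n → n < 2 ^ suc ⌊log₂ n ⌋
n<2^1+⌊log₂n⌋ n with 2 ^ suc ⌊log₂ n ⌋ ≤? n
... | no  2^≰n = ≰⇒> 2^≰n
... | yes 2^≤n = ⊥-elim (1+n≰n (subst (_≤ ⌊log₂ n ⌋) (⌊log₂[2^n]⌋≡n (suc ⌊log₂ n ⌋)) (⌊log₂⌋-mono-≤ 2^≤n)))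

-- Fixed-width messages

toBits : ∀ w → ℕ → Vec Bool w
toBits zero    k = []
toBits (suc w) k = (2 ^ w ≤ᵇ k) ∷ toBits w (if 2 ^ w ≤ᵇ k then k ∸ 2 ^ w else k)

fromBits : ∀ {w} → Vec Bool w → ℕ
fromBits []                = 0
fromBits {suc w} (bit ∷ v) = (if bit then 2 ^ w else 0) + fromBits v

fromBits-toBits : ∀ w k → k < 2 ^ w → fromBits (toBits w k) ≡ k
fromBits-toBits zero    zero    _ = refl
fromBits-toBits zero    (suc k) (s≤s ())
fromBits-toBits (suc w) k k<2^1+w with 2 ^ w ≤ᵇ k | ≤ᵇ-reflects-≤ (2 ^ w) k
... | true  | ofʸ 2^w≤k = trans (cong (2 ^ w +_) (fromBits-toBits w (k ∸ 2 ^ w) rest<)) (m+[n∸m]≡n 2^w≤k)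
  where
    rest< : k ∸ 2 ^ w < 2 ^ w
    rest< = +-cancelˡ-< (2 ^ w) (k ∸ 2 ^ w) (2 ^ w)
      (subst₂ _<_ (sym (m+[n∸m]≡n 2^w≤k)) (cong (2 ^ w +_) (+-identityʳ (2 ^ w))) k<2^1+w)
... | false | ofⁿ 2^w≰k = fromBits-toBits w k (≰⇒> 2^w≰k)

take-++ : ∀ {A : Set} {m l} (v : Vec A m) (w : Vec A l) → take m (v Vec.++ w) ≡ v
take-++ {m = m} v w = ++-injectiveˡ (take m (v Vec.++ w)) v (take++drop≡id m (v Vec.++ w))

drop-++ : ∀ {A : Set} {m l} (v : Vec A m) (w : Vec A l) → drop m (v Vec.++ w) ≡ w
drop-++ {m = m} v w = ++-injectiveʳ (take m (v Vec.++ w)) v (take++drop≡id m (v Vec.++ w))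

-- A message is a flag, a b-bit value field and a w-bit index field; the flag
-- tells whether the value field carries an aggregate.
module Messages {b : ℕ} (_⊕_ : Op₂ (Vec Bool b)) (⊕-comm : Commutative _≡_ _⊕_) (⊕-assoc : Associative _≡_ _⊕_)
                (w : ℕ) where
  open Aggregation _⊕_ ⊕-comm ⊕-assoc

  Message : Set
  Message = Msg (suc (b + w))

  encode : Maybe (Vec Bool b) → Message
  encode (just v) = true  ∷ (v Vec.++ replicate w false)
  encode nothing  = false ∷ replicate (b + w) false

  decode : Message → Maybe (Vec Bool b)
  decode (true  ∷ m) = just (take b m)
  decode (false ∷ _) = nothing

  decode-encode : ∀ a → decode (encode a) ≡ a
  decode-encode (just v) = cong just (take-++ v _)
  decode-encode nothing  = refl

  combine : Op₂ Message
  combine m m' = encode (decode m ⊙ decode m')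

  decode-combine : ∀ m m' → decode (combine m m') ≡ decode m ⊙ decode m'
  decode-combine m m' = decode-encode _

  combine-comm : Commutative _≡_ combine
  combine-comm m m' = cong encode (⊙-comm (decode m) (decode m'))

  combine-assoc : Associative _≡_ combine
  combine-assoc m m' m'' = cong encode (begin
    decode (combine m m') ⊙ decode m''   ≡⟨ cong (_⊙ decode m'') (decode-combine m m') ⟩
    decode m ⊙ decode m' ⊙ decode m''    ≡⟨ ⊙-assoc (decode m) (decode m') (decode m'') ⟩
    decode m ⊙ (decode m' ⊙ decode m'')  ≡⟨ cong (decode m ⊙_) (decode-combine m' m'') ⟨
    decode m ⊙ decode (combine m' m'')   ∎)
    where open ≡-Reasoning

  decodeAll : List Message → Maybe (Vec Bool b)
  decodeAll = foldr (λ m a → decode m ⊙ a) nothing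

  decodeAll-++ : ∀ ms ms' → decodeAll (ms ++ ms') ≡ decodeAll ms ⊙ decodeAll ms'
  decodeAll-++ []       ms' = refl
  decodeAll-++ (m ∷ ms) ms' =
    trans (cong (decode m ⊙_) (decodeAll-++ ms ms')) (sym (⊙-assoc (decode m) (decodeAll ms) (decodeAll ms')))

  decodeAll-if : ∀ s m → decodeAll (if s then m ∷ [] else []) ≡ (if s then decode m else nothing)
  decodeAll-if true  m = ⊙-identityʳ (decode m)
  decodeAll-if false m = refl

  decodeAll-concatMap : ∀ (h : ℕ → List Message) js → decodeAll (concatMap h js) ≡ ⨁ js (decodeAll ∘ h)
  decodeAll-concatMap h []       = refl
  decodeAll-concatMap h (j ∷ js) =
    trans (decodeAll-++ (h j) (concatMap h js)) (cong (decodeAll (h j) ⊙_) (decodeAll-concatMap h js))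

  decodeAll-filter : ∀ (f : ℕ → Message) q js →
                     decodeAll (map f (filterᵇ q js)) ≡ ⨁ js (λ k → if q k then decode (f k) else nothing)
  decodeAll-filter f q []       = refl
  decodeAll-filter f q (k ∷ js) with q k
  ... | true  = cong (decode (f k) ⊙_) (decodeAll-filter f q js)
  ... | false = decodeAll-filter f q js

  decode-foldr : ∀ m ms → decode (foldr combine m ms) ≡ decode m ⊙ decodeAll ms
  decode-foldr m []        = sym (⊙-identityʳ (decode m))
  decode-foldr m (m' ∷ ms) = begin
    decode (combine m' (foldr combine m ms))   ≡⟨ decode-combine m' (foldr combine m ms) ⟩
    decode m' ⊙ decode (foldr combine m ms)    ≡⟨ cong (decode m' ⊙_) (decode-foldr m ms) ⟩
    decode m' ⊙ (decode m ⊙ decodeAll ms)      ≡⟨ x∙yz≈y∙xz (decode m') (decode m) (decodeAll ms) ⟩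
    decode m ⊙ (decode m' ⊙ decodeAll ms)      ∎
    where open ≡-Reasoning

  decode-foldMaybe : ∀ ms → (foldMaybe combine ms >>= decode) ≡ decodeAll ms
  decode-foldMaybe []       = refl
  decode-foldMaybe (m ∷ ms) with foldMaybe combine ms | decode-foldMaybe ms
  ... | nothing | none≡ = trans (sym (⊙-identityʳ (decode m))) (cong (decode m ⊙_) none≡)
  ... | just a  | a≡    = trans (decode-combine m a) (cong (decode m ⊙_) a≡)

  encodeIndex : ℕ → Message
  encodeIndex k = false ∷ (replicate b false Vec.++ toBits w k)

  decodeIndex : Message → ℕ
  decodeIndex (_ ∷ m) = fromBits (drop b m)

  decodeIndex-encodeIndex : ∀ k → k < 2 ^ w → decodeIndex (encodeIndex k) ≡ k
  decodeIndex-encodeIndex k k<2^w =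
    trans (cong fromBits (drop-++ (replicate b false) (toBits w k))) (fromBits-toBits w k k<2^w)

-- The algorithm

-- Round 0 tells every edge the indices of its endpoints; in round suc r the
-- level-r blocks are contracted, and every edge joining two twin blocks hands
-- each of them the aggregate of the other.
module Protocol (n b : ℕ) (_⊕_ : Op₂ (Vec Bool b)) (⊕-comm : Commutative _≡_ _⊕_) (⊕-assoc : Associative _≡_ _⊕_) where
  open Aggregation _⊕_ ⊕-comm ⊕-assoc

  -- Bits per index, and also the number of levels after which one block covers the path.
  lg : ℕ
  lg = suc ⌊log₂ n ⌋

  open Messages _⊕_ ⊕-comm ⊕-assoc lg public

  Record : Set
  Record = Maybe (Message × Message)

  -- The oldest record of an edge, made in round 0, holds the indices of its endpoints.
  recordedIndex : Maybe Record → ℕ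
  recordedIndex (just (just (m , m'))) = decodeIndex m ⊓ decodeIndex m'
  recordedIndex _                      = 0

  indexOf : EdgeKnow (suc (b + lg)) → ℕ
  indexOf e = recordedIndex (last (EdgeKnow.ehist e))

  -- A record is (y on the lo-ID side , y on the hi-ID side); each side is sent the other's.
  exchange : Bool → Maybe Record → Message × Message
  exchange true (just (just (m , m'))) = m' , m
  exchange _    _                      = encode nothing , encode nothing

  -- lo tells whether the left endpoint has the smaller ID; yl and yr are the consensus values on the left and right.
  exchange-sends : ∀ merges lo contracted (yl yr : Message) → (contracted ≡ true → merges ≡ false) →
    let sent = exchange merges (just (if contracted then nothing else (if lo then just (yl , yr) else just (yr , yl))))
    in decode (if lo then proj₁ sent else proj₂ sent) ≡ (if merges then decode yr else nothing) ×
       decode (if lo then proj₂ sent else proj₁ sent) ≡ (if merges then decode yl else nothing)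
  exchange-sends false true  _     _  _  _ = refl , refl
  exchange-sends false false _     _  _  _ = refl , refl
  exchange-sends true  _     true  _  _  h with h refl
  ... | ()
  exchange-sends true  true  false _  _  _ = refl , refl
  exchange-sends true  false false _  _  _ = refl , refl

  contractAt : ℕ → EdgeKnow (suc (b + lg)) → Bool
  contractAt zero    _ = false
  contractAt (suc r) e = block r (indexOf e) ≡ᵇ block r (suc (indexOf e))

  nodeMsgAt : ℕ → NodeKnow b (suc (b + lg)) → Message
  nodeMsgAt zero    v = encodeIndex (NodeKnow.myIndex v)
  nodeMsgAt (suc r) v = encode (just (NodeKnow.input v))

  edgeMsgAt : ℕ → EdgeKnow (suc (b + lg)) → Message × Message
  edgeMsgAt zero    e = encode nothing , encode nothing
  edgeMsgAt (suc r) e = exchange (mergesAt r (indexOf e)) (head (EdgeKnow.ehist e))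

  readHistory : ℕ → Vec Bool b → List (Message × Maybe Message) → Maybe (Vec Bool b) × Maybe (Vec Bool b)
  readHistory k v []       = just v , just v
  readHistory k v (_ ∷ []) = just v , just v
  readHistory k v ((_ , s) ∷ h@(_ ∷ older)) =
    absorbTwin (isOdd (block (length older) k)) (s >>= decode) (readHistory k v h)

  readHistory-∷ : ∀ {r} k v (e : Message × Maybe Message) h → length h ≡ suc r →
    readHistory k v (e ∷ h) ≡ absorbTwin (isOdd (block r k)) (proj₂ e >>= decode) (readHistory k v h)
  readHistory-∷ k v e (_ ∷ older) len rewrite suc-injective len = refl

  report : NodeKnow b (suc (b + lg)) → Vec Bool b × Vec Bool b
  report (mkNK _ k v h) = Product.map (fromMaybe v) (fromMaybe v) (readHistory k v h)

  algorithm : Algorithm n b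
  algorithm = record
    { B         = suc (b + lg)
    ; rounds    = suc lg
    ; contract  = contractAt
    ; nodeMsg   = nodeMsgAt
    ; opC       = λ _ → combine
    ; opC-comm  = λ _ → combine-comm
    ; opC-assoc = λ _ → combine-assoc
    ; edgeMsg   = edgeMsgAt
    ; opA       = λ _ → combine
    ; opA-comm  = λ _ → combine-comm
    ; opA-assoc = λ _ → combine-assoc
    ; output    = report
    }

-- Correctness

module Execution (n b : ℕ) (_⊕_ : Op₂ (Vec Bool b)) (⊕-comm : Commutative _≡_ _⊕_) (⊕-assoc : Associative _≡_ _⊕_)
                 (ids : ℕ → ℕ) (x : ℕ → Vec Bool b) where
  open Aggregation _⊕_ ⊕-comm ⊕-assoc
  open Selection n x
  open Protocol n b _⊕_ ⊕-comm ⊕-assoc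
  open Run algorithm ids x

  -- The local definitions of Run.step, which cannot be referred to from outside it.
  module Round (r : ℕ) (ns : NodeStates) (es : EdgeStates) where
    c : ℕ → Bool
    c j = contractAt r (es j)
    xv : ℕ → Message
    xv i = nodeMsgAt r (ns i)
    y : ℕ → Message
    y i = foldr combine (xv i) (map xv (filterᵇ (λ k → sameSN c i k ∧ not (k ≡ᵇ i)) (upTo n)))
    newE : ℕ → Record
    newE j = if c j then nothing
             else (if leftIsLo j then just (y j , y (suc j)) else just (y (suc j) , y j))
    es' : EdgeStates
    es' j = mkEK (EdgeKnow.loId (es j)) (EdgeKnow.hiId (es j)) (newE j ∷ EdgeKnow.ehist (es j))
    zLeft zRight : ℕ → Message
    zLeft j  = if leftIsLo j then proj₁ (edgeMsgAt r (es' j)) else proj₂ (edgeMsgAt r (es' j))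
    zRight j = if leftIsLo j then proj₂ (edgeMsgAt r (es' j)) else proj₁ (edgeMsgAt r (es' j))
    fromEdge : ℕ → ℕ → List Message
    fromEdge i j = if c j then []
                   else ((if sameSN c i j then zLeft j ∷ [] else []) ++ (if sameSN c i (suc j) then zRight j ∷ [] else []))
    incoming : ℕ → List Message
    incoming i = concatMap (fromEdge i) (upTo (n ∸ 1))

  indexRecord : ℕ → Record
  indexRecord j = if leftIsLo j then just (encodeIndex j , encodeIndex (suc j))
                  else just (encodeIndex (suc j) , encodeIndex j)

  recordedIndex-indexRecord : ∀ j → suc j < n → recordedIndex (just (indexRecord j)) ≡ j
  recordedIndex-indexRecord j 1+j<n = by-orientation (leftIsLo j)
    where
      decodes : ∀ k → k < n → decodeIndex (encodeIndex k) ≡ k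
      decodes k k<n = decodeIndex-encodeIndex k (<-trans k<n (n<2^1+⌊log₂n⌋ n))
      by-orientation : ∀ lo → recordedIndex (just (if lo then just (encodeIndex j , encodeIndex (suc j))
                                                   else just (encodeIndex (suc j) , encodeIndex j))) ≡ j
      by-orientation true  = trans (cong₂ _⊓_ (decodes j (<-trans (n<1+n j) 1+j<n)) (decodes (suc j) 1+j<n))
                                   (m≤n⇒m⊓n≡m (n≤1+n j))
      by-orientation false = trans (cong₂ _⊓_ (decodes (suc j) 1+j<n) (decodes j (<-trans (n<1+n j) 1+j<n)))
                                   (m≥n⇒m⊓n≡n (n≤1+n j))

  -- Invariant r holds after rounds 0, ..., r.
  record Invariant (r : ℕ) (st : NodeStates × EdgeStates) : Set where
    field
      index-kept     : ∀ i → NodeKnow.myIndex (proj₁ st i) ≡ i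
      input-kept     : ∀ i → NodeKnow.input (proj₁ st i) ≡ x i
      rounds-heard   : ∀ i → length (NodeKnow.hist (proj₁ st i)) ≡ suc r
      knows-within   : ∀ i → i < n → readHistory i (x i) (NodeKnow.hist (proj₁ st i)) ≡ within r i
      index-recorded : ∀ j → last (EdgeKnow.ehist (proj₂ st j)) ≡ just (indexRecord j)

  module Level (r : ℕ) (ns : NodeStates) (es : EdgeStates) (I : Invariant r (ns , es)) where
    open Round (suc r) ns es
    open Invariant I

    contracts : ∀ j → suc j < n → c j ≡ (block r j ≡ᵇ block r (suc j))
    contracts j 1+j<n = cong (λ i → block r i ≡ᵇ block r (suc i))
      (trans (cong recordedIndex (index-recorded j)) (recordedIndex-indexRecord j 1+j<n))

    same-supernode : ∀ i k → i < n → k < n → sameSN c i k ≡ (block r k ≡ᵇ block r i)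
    same-supernode i k i<n k<n = by-order (≤-total i k)
      where
        steps : ∀ a t → a + t < n → and (map c (map (a +_) (upTo t))) ≡ (block r a ≡ᵇ block r (a + t))
        steps a t a+t<n = and-steps (block r) (block-mono r) c a t (λ j j< → contracts j (≤-<-trans j< a+t<n))
        by-order : i ≤ k ⊎ k ≤ i → and (map c (map ((i ⊓ k) +_) (upTo ((i ⊔ k) ∸ (i ⊓ k))))) ≡ (block r k ≡ᵇ block r i)
        by-order (inj₁ i≤k) rewrite m≤n⇒m⊓n≡m i≤k | m≤n⇒m⊔n≡n i≤k =
          trans (steps i (k ∸ i) (subst (_< n) (sym (m+[n∸m]≡n i≤k)) k<n))
                (trans (cong (λ m → block r i ≡ᵇ block r m) (m+[n∸m]≡n i≤k)) (≡ᵇ-sym (block r i) (block r k)))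
        by-order (inj₂ k≤i) rewrite m≥n⇒m⊓n≡n k≤i | m≥n⇒m⊔n≡m k≤i =
          trans (steps k (i ∸ k) (subst (_< n) (sym (m+[n∸m]≡n k≤i)) i<n))
                (cong (λ m → block r k ≡ᵇ block r m) (m+[n∸m]≡n k≤i))

    decode-input : ∀ k → decode (xv k) ≡ just (x k)
    decode-input k = trans (decode-encode _) (cong just (input-kept k))

    consensus : ∀ i → i < n → decode (y i) ≡ blockAgg r (block r i)
    consensus i i<n = begin
      decode (y i)
        ≡⟨ decode-foldr (xv i) (map xv (filterᵇ others (upTo n))) ⟩
      decode (xv i) ⊙ decodeAll (map xv (filterᵇ others (upTo n)))
        ≡⟨ cong₂ _⊙_ (trans (decode-input i) (sym (select-single i i<n)))
                     (trans (decodeAll-filter xv others (upTo n)) (⨁-cong n heard)) ⟩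
      select (_≡ᵇ i) ⊙ select (λ k → (block r k ≡ᵇ block r i) ∧ not (k ≡ᵇ i))
        ≡⟨ select-∨ (_≡ᵇ i) (λ k → (block r k ≡ᵇ block r i) ∧ not (k ≡ᵇ i)) exclusive ⟨
      select (λ k → (k ≡ᵇ i) ∨ ((block r k ≡ᵇ block r i) ∧ not (k ≡ᵇ i)))
        ≡⟨ select-cong (λ k _ → absorb k) ⟩
      blockAgg r (block r i) ∎
      where
        open ≡-Reasoning
        others : ℕ → Bool
        others k = sameSN c i k ∧ not (k ≡ᵇ i)
        heard : ∀ k → k < n → (if others k then decode (xv k) else nothing)
                              ≡ keep ((block r k ≡ᵇ block r i) ∧ not (k ≡ᵇ i)) k
        heard k k<n =
          cong₂ (λ b v → if b ∧ not (k ≡ᵇ i) then v else nothing) (same-supernode i k i<n k<n) (decode-input k)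
        exclusive : ∀ k → T (k ≡ᵇ i) → T ((block r k ≡ᵇ block r i) ∧ not (k ≡ᵇ i)) → ⊥
        exclusive k k≡i rest =
          subst T (Equivalence.to T-not-≡ (proj₂ (Equivalence.to (T-∧ {block r k ≡ᵇ block r i}) rest))) k≡i
        absorb : ∀ k → ((k ≡ᵇ i) ∨ ((block r k ≡ᵇ block r i) ∧ not (k ≡ᵇ i))) ≡ (block r k ≡ᵇ block r i)
        absorb k with k ≡ᵇ i | ≡ᵇ-reflects-≡ k i
        ... | true  | ofʸ refl = sym (≡ᵇ-refl (block r k))
        ... | false | _        = ∧-identityʳ _

    contracted-not-merging : ∀ j → suc j < n → c j ≡ true → mergesAt r j ≡ false
    contracted-not-merging j 1+j<n contracted =
      trans (cong (not (isOdd (block r j)) ∧_) (≢⇒≡ᵇ≡false (λ e → 1+n≢n (trans (sym e) (sym same))))) (∧-zeroʳ _)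
      where
        same : block r j ≡ block r (suc j)
        same = ≡ᵇ⇒≡ _ _ (Equivalence.from T-≡ (trans (sym (contracts j 1+j<n)) contracted))

    sent : ∀ j → suc j < n →
           decode (zLeft j) ≡ (if mergesAt r j then blockAgg r (block r (suc j)) else nothing) ×
           decode (zRight j) ≡ (if mergesAt r j then blockAgg r (block r j) else nothing)
    sent j 1+j<n =
      let (toLeft , toRight) = exchange-sends merges (leftIsLo j) (c j) (y j) (y (suc j))
                                 (λ contracted → trans merges≡ (contracted-not-merging j 1+j<n contracted))
      in trans toLeft (cong₂ (λ m v → if m then v else nothing) merges≡ (consensus (suc j) 1+j<n)) ,
         trans toRight (cong₂ (λ m v → if m then v else nothing) merges≡ (consensus j (<-trans (n<1+n j) 1+j<n)))
      where
        merges : Bool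
        merges = mergesAt r (indexOf (es' j))
        merges≡ : merges ≡ mergesAt r j
        merges≡ = cong (mergesAt r)
          (trans (cong recordedIndex (last-∷ (newE j) {EdgeKnow.ehist (es j)} (index-recorded j)))
                 (recordedIndex-indexRecord j 1+j<n))

    heard-from : ∀ i j → i < n → suc j < n →
      decodeAll (fromEdge i j) ≡ (if joinsTwin r (block r i) j then blockAgg r (twin (block r i)) else nothing)
    heard-from i j i<n 1+j<n = by-contraction (c j) refl
      where
        β : ℕ
        β = block r i
        delivered : Bool → Maybe (Vec Bool b) → Maybe (Vec Bool b)
        delivered s v = if s then v else nothing

        by-contraction : ∀ cj → c j ≡ cj →
          decodeAll (if cj then []
                     else ((if sameSN c i j then zLeft j ∷ [] else []) ++ (if sameSN c i (suc j) then zRight j ∷ [] else [])))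
            ≡ delivered (joinsTwin r β j) (blockAgg r (twin β))
        by-contraction true  contracted =
          sym (if-cong (joinsTwin-not-merging r β j (contracted-not-merging j 1+j<n contracted)))
        by-contraction false _ = begin
          decodeAll ((if sameSN c i j then zLeft j ∷ [] else []) ++ (if sameSN c i (suc j) then zRight j ∷ [] else []))
            ≡⟨ decodeAll-++ (if sameSN c i j then zLeft j ∷ [] else []) (if sameSN c i (suc j) then zRight j ∷ [] else []) ⟩
          _ ≡⟨ cong₂ _⊙_ (decodeAll-if (sameSN c i j) (zLeft j)) (decodeAll-if (sameSN c i (suc j)) (zRight j)) ⟩
          delivered (sameSN c i j) (decode (zLeft j)) ⊙ delivered (sameSN c i (suc j)) (decode (zRight j))
            ≡⟨ cong₂ _⊙_ (cong₂ delivered (same-supernode i j i<n (<-trans (n<1+n j) 1+j<n)) (proj₁ (sent j 1+j<n)))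
                         (cong₂ delivered (same-supernode i (suc j) i<n 1+j<n) (proj₂ (sent j 1+j<n))) ⟩
          _ ≡⟨ delivered-to r β j ⟩
          delivered (joinsTwin r β j) (blockAgg r (twin β)) ∎
          where open ≡-Reasoning

    received : ∀ i → i < n → (foldMaybe combine (incoming i) >>= decode) ≡ blockAgg r (twin (block r i))
    received i i<n = begin
      (foldMaybe combine (incoming i) >>= decode) ≡⟨ decode-foldMaybe (incoming i) ⟩
      decodeAll (incoming i)                     ≡⟨ decodeAll-concatMap (fromEdge i) (upTo (n ∸ 1)) ⟩
      ⨁ (upTo (n ∸ 1)) (decodeAll ∘ fromEdge i)  ≡⟨ ⨁-cong (n ∸ 1) (λ j j<n-1 → heard-from i j i<n (<∸1⇒1+< j<n-1)) ⟩
      ⨁ (upTo (n ∸ 1)) (λ j → if joinsTwin r (block r i) j then blockAgg r (twin (block r i)) else nothing)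
        ≡⟨ collect-twin r (block r i) (block-mono r (<⇒≤∸1 i<n)) ⟩
      blockAgg r (twin (block r i)) ∎
      where open ≡-Reasoning

    preserved : Invariant (suc r) (step (suc r) (ns , es))
    preserved = record
      { index-kept     = index-kept
      ; input-kept     = input-kept
      ; rounds-heard   = λ i → cong suc (rounds-heard i)
      ; knows-within   = λ i i<n → begin
          readHistory i (x i) ((y i , foldMaybe combine (incoming i)) ∷ NodeKnow.hist (ns i))
            ≡⟨ readHistory-∷ i (x i) (y i , foldMaybe combine (incoming i)) (NodeKnow.hist (ns i)) (rounds-heard i) ⟩
          absorbTwin (isOdd (block r i)) (foldMaybe combine (incoming i) >>= decode)
                     (readHistory i (x i) (NodeKnow.hist (ns i)))
            ≡⟨ cong₂ (absorbTwin (isOdd (block r i))) (received i i<n) (knows-within i i<n) ⟩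
          absorbTwin (isOdd (block r i)) (blockAgg r (twin (block r i))) (within r i)
            ≡⟨ within-suc r i ⟨
          within (suc r) i ∎
      ; index-recorded = λ j → last-∷ (newE j) {EdgeKnow.ehist (es j)} (index-recorded j)
      }
      where open ≡-Reasoning

  module Start where
    open Round 0 initNodes initEdges

    -- In round 0 no edge is contracted, so every supernode is a single node.
    alone : ∀ i k → (sameSN c i k ∧ not (k ≡ᵇ i)) ≡ false
    alone i k with k ≡ᵇ i | ≡ᵇ-reflects-≡ k i
    ... | true  | _        = ∧-zeroʳ (sameSN c i k)
    ... | false | ofⁿ k≢i = trans (∧-identityʳ _) (no-edges ((i ⊔ k) ∸ (i ⊓ k)) refl)
      where
        no-edges : ∀ d → (i ⊔ k) ∸ (i ⊓ k) ≡ d → and (map c (map ((i ⊓ k) +_) (upTo d))) ≡ false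
        no-edges zero    d≡0 = ⊥-elim (k≢i (≤-antisym
          (≤-trans (m≤n⊔m i k) (≤-trans (m∸n≡0⇒m≤n d≡0) (m⊓n≤m i k)))
          (≤-trans (m≤m⊔n i k) (≤-trans (m∸n≡0⇒m≤n d≡0) (m⊓n≤n i k)))))
        no-edges (suc d) _   = refl

    consensus : ∀ i → y i ≡ encodeIndex i
    consensus i = cong (λ ks → foldr combine (encodeIndex i) (map xv ks))
      (filter-none (T? ∘ λ k → sameSN c i k ∧ not (k ≡ᵇ i)) {upTo n} (All.tabulate (λ {k} _ → subst T (alone i k))))

    started : Invariant 0 (step 0 (initNodes , initEdges))
    started = record
      { index-kept     = λ i → refl
      ; input-kept     = λ i → refl
      ; rounds-heard   = λ i → refl
      ; knows-within   = λ i i<n → sym (within-zero i i<n)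
      ; index-recorded = λ j → cong₂ (λ m m' → just (if leftIsLo j then just (m , m') else just (m' , m)))
                                      (consensus j) (consensus (suc j))
      }

  runFrom-invariant : ∀ t r st → Invariant r st → Invariant (t + r) (runFrom (suc r) t st)
  runFrom-invariant zero    r st inv = inv
  runFrom-invariant (suc t) r st inv = subst (λ m → Invariant m (runFrom (suc (suc r)) t (step (suc r) st))) (+-suc t r)
    (runFrom-invariant t (suc r) (step (suc r) st) (Level.preserved r (proj₁ st) (proj₂ st) inv))

  correct : ∀ k → k < n → result k ≡ (prefixAgg _⊕_ x k , suffixAgg _⊕_ x n k)
  correct k k<n = begin
    result k ≡⟨⟩
    Product.map (fromMaybe v) (fromMaybe v) (readHistory (NodeKnow.myIndex final) v (NodeKnow.hist final))
      ≡⟨ cong₂ (λ i u → Product.map (fromMaybe u) (fromMaybe u) (readHistory i u (NodeKnow.hist final)))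
               (index-kept k) (input-kept k) ⟩
    Product.map (fromMaybe (x k)) (fromMaybe (x k)) (readHistory k (x k) (NodeKnow.hist final))
      ≡⟨ cong (Product.map (fromMaybe (x k)) (fromMaybe (x k)))
              (trans (knows-within k k<n) (within-top (lg + 0) vanish k k<n)) ⟩
    prefixAgg _⊕_ x k , suffixAgg _⊕_ x n k ∎
    where
      open ≡-Reasoning
      open Invariant (runFrom-invariant lg 0 (step 0 (initNodes , initEdges)) Start.started)
      final : NodeKnow b (suc (b + lg))
      final = finalNodes k
      v : Vec Bool b
      v = NodeKnow.input final
      vanish : ∀ k' → k' < n → block (lg + 0) k' ≡ 0
      vanish k' k'<n =
        block-vanishes (lg + 0) k' (subst (λ e → k' < 2 ^ e) (sym (+-identityʳ lg)) (<-trans k'<n (n<2^1+⌊log₂n⌋ n)))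

-- Complexity

polylog-mono : ∀ n {d e} → d ≤ e → polylog d n ≤ polylog e n
polylog-mono n d≤e = *-mono-≤ d≤e (^-monoʳ-≤ (suc ⌊log₂ n ⌋) d≤e)

polylog-+ : ∀ n d e → polylog d n + polylog e n ≤ polylog (d + e) n
polylog-+ n d e = begin
  d * ℓ ^ d + e * ℓ ^ e
    ≤⟨ +-mono-≤ (*-monoʳ-≤ d (^-monoʳ-≤ ℓ (m≤m+n d e))) (*-monoʳ-≤ e (^-monoʳ-≤ ℓ (m≤n+m e d))) ⟩
  d * ℓ ^ (d + e) + e * ℓ ^ (d + e) ≡⟨ *-distribʳ-+ (ℓ ^ (d + e)) d e ⟨
  (d + e) * ℓ ^ (d + e)             ∎
  where
    open ≤-Reasoning
    ℓ : ℕ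
    ℓ = suc ⌊log₂ n ⌋

1+lg≤polylog₂ : ∀ n → suc (suc ⌊log₂ n ⌋) ≤ polylog 2 n
1+lg≤polylog₂ n = begin
  suc ℓ          ≤⟨ +-monoˡ-≤ ℓ (s≤s z≤n) ⟩
  ℓ + ℓ          ≡⟨ cong (ℓ +_) (+-identityʳ ℓ) ⟨
  2 * ℓ          ≡⟨ cong (2 *_) (*-identityʳ ℓ) ⟨
  2 * ℓ ^ 1      ≤⟨ *-monoʳ-≤ 2 (^-monoʳ-≤ ℓ {1} {2} (s≤s z≤n)) ⟩
  2 * ℓ ^ 2      ∎
  where
    open ≤-Reasoning
    ℓ : ℕ
    ℓ = suc ⌊log₂ n ⌋

-- The algorithm reads the nodes' indices instead of their IDs, so neither the
-- ID hypothesis nor 1 ≤ n is needed.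
lemmaA2 : (c : ℕ) → ∃[ d ] ((n b : ℕ) → 1 ≤ n → b ≤ polylog c n →
          (_⊕_ : Op₂ (Vec Bool b)) → Commutative _≡_ _⊕_ → Associative _≡_ _⊕_ →
          Σ[ A ∈ Algorithm n b ]
            ((Algorithm.B A ≤ polylog d n) × (Algorithm.rounds A ≤ polylog d n) ×
             ((ids : ℕ → ℕ) → ValidIDs c n ids → (x : ℕ → Vec Bool b) →
              (k : ℕ) → k < n →
              Run.result A ids x k ≡ (prefixAgg _⊕_ x k , suffixAgg _⊕_ x n k))))
lemmaA2 c = c + 2 , λ n b _ b≤polylog _⊕_ ⊕-comm ⊕-assoc →
  let open ≤-Reasoning in
  Protocol.algorithm n b _⊕_ ⊕-comm ⊕-assoc ,
  (begin
    suc (b + suc ⌊log₂ n ⌋)        ≡⟨ +-suc b (suc ⌊log₂ n ⌋) ⟨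
    b + suc (suc ⌊log₂ n ⌋)        ≤⟨ +-mono-≤ b≤polylog (1+lg≤polylog₂ n) ⟩
    polylog c n + polylog 2 n      ≤⟨ polylog-+ n c 2 ⟩
    polylog (c + 2) n              ∎) ,
  ≤-trans (1+lg≤polylog₂ n) (polylog-mono n (m≤n+m 2 c)) ,
  λ ids _ x → Execution.correct n b _⊕_ ⊕-comm ⊕-assoc ids x
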